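{- For any two positive integers $m\le n$, $\mathsf{tree}\text{ - }\alpha(L(K_{m,n}))=\alpha(L(K_{m,m}))=m$.
   Context: $K_{m,n}$ is the complete bipartite graph with parts of sizes $m$ and $n$; $L(\cdot)$ denotes the line graph; $\alpha$ is the independence number. A tree decomposition of $G$ is a pair $(T,\beta)$ with $T$ a tree and $\beta:V(T)\to 2^{V(G)}$ such that every vertex lies in some bag, every edge has both endpoints in some bag, and for each vertex the nodes whose bags contain it induce a subtree. Its independence number is $\max_t\alpha(G[\beta(t)])$; $\mathsf{tree}\text{ - }\alpha(G)$ is the minimum independence number over all tree decompositions of $G$. -}

module Defs where

open import Data.Nat using (ℕ; _≤_)
open import Data.Fin using (Fin)
open import Data.Product using (Σ; ∃; _×_; _,_)
open import Data.Sum using (_⊎_)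
open import Data.List using (List; []; _∷_; length; _∷ʳ_)
open import Data.List.Relation.Unary.All using (All)
open import Data.List.Relation.Unary.AllPairs using (AllPairs)
open import Data.List.Relation.Unary.Linked using (Linked)
open import Relation.Binary.PropositionalEquality using (_≡_; _≢_)
open import Relation.Nullary using (¬_)
open import Data.Unit using () renaming (⊤ to Unit)

record Graph : Set₁ where
  field
    V      : Set
    Adj    : V → V → Set
    sym    : ∀ {u v} → Adj u v → Adj v u
    irrefl : ∀ {v} → ¬ Adj v v
open Graph public

-- Edges of K_{m,n} are pairs (i , j) with i ∈ Fin m, j ∈ Fin n;
-- two distinct edges are adjacent in the line graph iff they share an
-- endpoint, i.e. agree in the first or in the second coordinate.

LAdj : (m n : ℕ) → Fin m × Fin n → Fin m × Fin n → Set
LAdj m n (a , b) (c , d) = ((a , b) ≢ (c , d)) × ((a ≡ c) ⊎ (b ≡ d))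

LKmn : ℕ → ℕ → Graph
LKmn m n = record
  { V      = Fin m × Fin n
  ; Adj    = LAdj m n
  ; sym    = λ { (ne , inj) → (λ eq → ne (symm eq)) , swap inj }
  ; irrefl = λ { (ne , _) → ne refl' }
  }
  where
  open import Relation.Binary.PropositionalEquality using () renaming (sym to symm; refl to refl')
  open import Data.Sum using (inj₁; inj₂)
  swap : ∀ {a c : Fin m} {b d : Fin n} → (a ≡ c) ⊎ (b ≡ d) → (c ≡ a) ⊎ (d ≡ b)
  swap (inj₁ p) = inj₁ (symm p)
  swap (inj₂ q) = inj₂ (symm q)

-- Independent sets and the independence number of an induced subgraph
-- G[S] (S given as a predicate on vertices).

IsIndep : (G : Graph) → (V G → Set) → List (V G) → Set
IsIndep G S xs = AllPairs _≢_ xs × All S xs × AllPairs (λ u v → ¬ Adj G u v) xs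

αLe : (G : Graph) → (V G → Set) → ℕ → Set
αLe G S k = ∀ xs → IsIndep G S xs → length xs ≤ k

AlphaIs : Graph → ℕ → Set
AlphaIs G k =
  (Σ (List (V G)) λ xs → IsIndep G (λ _ → Unit) xs × length xs ≡ k)
  × αLe G (λ _ → Unit) k

data WalkIn {t : ℕ} (A : Fin t → Fin t → Set) (P : Fin t → Set)
     : Fin t → Fin t → Set where
  here  : ∀ {a} → P a → WalkIn A P a a
  there : ∀ {a b c} → P a → A a b → WalkIn A P b c → WalkIn A P a c

record IsTree (t : ℕ) (A : Fin t → Fin t → Set) : Set where
  field
    sym       : ∀ {a b} → A a b → A b a
    irrefl    : ∀ {a} → ¬ A a a
    connected : ∀ a b → WalkIn A (λ _ → Unit) a b
    acyclic   : ∀ x ys → 2 ≤ length ys → AllPairs _≢_ (x ∷ ys)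
                → ¬ Linked A ((x ∷ ys) ∷ʳ x)

record TreeDecomposition (G : Graph) : Set₁ where
  field
    t      : ℕ
    TAdj   : Fin t → Fin t → Set
    isTree : IsTree t TAdj
    bag    : Fin t → V G → Set
    cover  : ∀ v → ∃ λ s → bag s v
    edge   : ∀ u v → Adj G u v → ∃ λ s → bag s u × bag s v
    subtree : ∀ v a b → bag a v → bag b v → WalkIn TAdj (λ s → bag s v) a b
open TreeDecomposition public

TreeAlphaIs : Graph → ℕ → Set₁
TreeAlphaIs G k =
  (Σ (TreeDecomposition G) λ D → ∀ s → αLe G (bag D s) k)
  × (∀ (D : TreeDecomposition G) → ∃ λ s → Σ (List (V G)) λ xs →
       IsIndep G (bag D s) xs × k ≤ length xs)

-- An independent set of L(K_{m,n}) is a matching, so it has at most m edges; the one-bag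
-- decomposition gives the upper bound.  By Hall's
-- theorem in König's form, each bag either contains a matching of size m or misses every edge of
-- some rectangle A × C with ∣ A ∣ + ∣ C ∣ > n.  Such a rectangle is connected in the line graph,
-- so the nodes whose bags meet it form a subtree; and as m ≤ n, two such rectangles always share
-- a row or a column, so these subtrees pairwise intersect.  If every bag missed a rectangle, point
-- each node towards the subtree of its rectangle: some two adjacent nodes point at each other, and
-- their subtrees lie on opposite sides of the edge between them.

module Submission where

open import Defs
open import Data.Nat using (ℕ; _≤_)
open import Data.Product using (_×_)

module Finite where

  open import Data.Nat using (ℕ; zero; suc; _+_; _≤_; _<_)
  open import Data.Nat.Properties using (<-irrefl; +-suc; +-comm; +-identityʳ; m≤m+n; module ≤-Reasoning)
  open import Data.Fin using (Fin; zero; suc; _≟_)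
  open import Data.Fin.Properties using (injective⇒≤)
  open import Data.Fin.Subset
  open import Data.Fin.Subset.Properties
  open import Data.Vec using (_∷_; []; tabulate)
  open import Data.Vec.Properties using (lookup∘tabulate; []=⇒lookup; lookup⇒[]=)
  open import Data.List using (List; _∷_; length; lookup)
  open import Data.List.Membership.Propositional.Properties using (∈-lookup)
  open import Data.List.Relation.Unary.All as All using ()
  open import Data.List.Relation.Unary.AllPairs using (AllPairs; _∷_)
  open import Data.Product using (∃; _,_)
  open import Data.Sum using (_⊎_; inj₁; inj₂)
  open import Function using (Injective)
  open import Relation.Nullary using (Dec; yes; no; does; contradiction)
  open import Relation.Nullary.Decidable using (dec-true)
  open import Relation.Binary.PropositionalEquality as ≡ using (_≡_; _≢_; refl; trans; cong; subst)

  private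
    variable
      k n : ℕ

  fromDec : {P : Fin k → Set} → (∀ j → Dec (P j)) → Subset k
  fromDec P? = tabulate (λ j → does (P? j))

  module _ {P : Fin k → Set} (P? : ∀ j → Dec (P j)) where

    ∈-fromDec⁺ : ∀ {j} → P j → j ∈ fromDec P?
    ∈-fromDec⁺ {j} p = lookup⇒[]= j _ (trans (lookup∘tabulate _ j) (dec-true (P? j) p))

    ∈-fromDec⁻ : ∀ {j} → j ∈ fromDec P? → P j
    ∈-fromDec⁻ {j} j∈ with P? j | trans (≡.sym (lookup∘tabulate _ j)) ([]=⇒lookup j∈)
    ... | yes p | _ = p
    ... | no _  | ()

  ∣p∪q∣+∣p∩q∣≡∣p∣+∣q∣ : ∀ (p q : Subset n) → ∣ p ∪ q ∣ + ∣ p ∩ q ∣ ≡ ∣ p ∣ + ∣ q ∣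
  ∣p∪q∣+∣p∩q∣≡∣p∣+∣q∣ []            []            = refl
  ∣p∪q∣+∣p∩q∣≡∣p∣+∣q∣ (inside  ∷ p) (inside  ∷ q) =
    cong suc (trans (+-suc _ _) (trans (cong suc (∣p∪q∣+∣p∩q∣≡∣p∣+∣q∣ p q)) (≡.sym (+-suc _ _))))
  ∣p∪q∣+∣p∩q∣≡∣p∣+∣q∣ (inside  ∷ p) (outside ∷ q) = cong suc (∣p∪q∣+∣p∩q∣≡∣p∣+∣q∣ p q)
  ∣p∪q∣+∣p∩q∣≡∣p∣+∣q∣ (outside ∷ p) (inside  ∷ q) =
    trans (cong suc (∣p∪q∣+∣p∩q∣≡∣p∣+∣q∣ p q)) (≡.sym (+-suc _ _))
  ∣p∪q∣+∣p∩q∣≡∣p∣+∣q∣ (outside ∷ p) (outside ∷ q) = ∣p∪q∣+∣p∩q∣≡∣p∣+∣q∣ p q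

  ∣p∪q∣≤∣p∣+∣q∣ : ∀ (p q : Subset n) → ∣ p ∪ q ∣ ≤ ∣ p ∣ + ∣ q ∣
  ∣p∪q∣≤∣p∣+∣q∣ p q = subst (∣ p ∪ q ∣ ≤_) (∣p∪q∣+∣p∩q∣≡∣p∣+∣q∣ p q) (m≤m+n _ _)

  ∣p∣≤1+∣p-x∣ : ∀ (p : Subset n) x → ∣ p ∣ ≤ suc ∣ p - x ∣
  ∣p∣≤1+∣p-x∣ p x = begin
    ∣ p ∣                   ≤⟨ p⊆q⇒∣p∣≤∣q∣ p⊆p-x∪⁅x⁆ ⟩
    ∣ (p - x) ∪ ⁅ x ⁆ ∣     ≤⟨ ∣p∪q∣≤∣p∣+∣q∣ (p - x) ⁅ x ⁆ ⟩
    ∣ p - x ∣ + ∣ ⁅ x ⁆ ∣   ≡⟨ cong (∣ p - x ∣ +_) (∣⁅x⁆∣≡1 x) ⟩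
    ∣ p - x ∣ + 1           ≡⟨ +-comm _ 1 ⟩
    suc ∣ p - x ∣           ∎
    where
    open ≤-Reasoning
    p⊆p-x∪⁅x⁆ : p ⊆ (p - x) ∪ ⁅ x ⁆
    p⊆p-x∪⁅x⁆ {y} y∈p with y ≟ x
    ... | yes refl = x∈p∪q⁺ (inj₂ (x∈⁅x⁆ x))
    ... | no  y≢x  = x∈p∪q⁺ (inj₁ (x∈p∧x≢y⇒x∈p-y y∈p y≢x))

  x∈p-y⇒x≢y : ∀ (p : Subset n) {x y} → x ∈ p - y → x ≢ y
  x∈p-y⇒x≢y p {x} x∈p-x refl = <-irrefl (cong ∣_∣ (p─q─q≡p─q p ⁅ x ⁆)) (x∈p⇒∣p-x∣<∣p∣ x∈p-x)

  ∣p∣>0⇒Nonempty : ∀ (p : Subset n) → 0 < ∣ p ∣ → Nonempty p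
  ∣p∣>0⇒Nonempty {n} p 0<∣p∣ with nonempty? p
  ... | yes ne = ne
  ... | no  ¬ne = contradiction (subst (λ q → 0 < ∣ q ∣) (Empty-unique ¬ne) 0<∣p∣)
                                (λ 0<∣⊥∣ → <-irrefl (≡.sym (∣⊥∣≡0 n)) 0<∣⊥∣)

  Empty[p∩q]⇒∣p∣+∣q∣≤n : ∀ (p q : Subset n) → Empty (p ∩ q) → ∣ p ∣ + ∣ q ∣ ≤ n
  Empty[p∩q]⇒∣p∣+∣q∣≤n {n} p q empty = begin
    ∣ p ∣ + ∣ q ∣             ≡⟨ ≡.sym (∣p∪q∣+∣p∩q∣≡∣p∣+∣q∣ p q) ⟩
    ∣ p ∪ q ∣ + ∣ p ∩ q ∣     ≡⟨ cong (λ r → ∣ p ∪ q ∣ + ∣ r ∣) (Empty-unique empty) ⟩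
    ∣ p ∪ q ∣ + ∣ ⊥ {n} ∣     ≡⟨ cong (∣ p ∪ q ∣ +_) (∣⊥∣≡0 n) ⟩
    ∣ p ∪ q ∣ + 0             ≡⟨ +-identityʳ _ ⟩
    ∣ p ∪ q ∣                 ≤⟨ ∣p∣≤n (p ∪ q) ⟩
    n                         ∎
    where open ≤-Reasoning

  lookup-injective : ∀ {A : Set} {xs : List A} → AllPairs _≢_ xs → Injective _≡_ _≡_ (lookup xs)
  lookup-injective (_ ∷ _)        {zero}  {zero}  _  = refl
  lookup-injective (x≢xs ∷ _)     {zero}  {suc j} eq = contradiction eq (All.lookup x≢xs (∈-lookup j))
  lookup-injective (x≢xs ∷ _)     {suc i} {zero}  eq = contradiction (≡.sym eq) (All.lookup x≢xs (∈-lookup i))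
  lookup-injective (_ ∷ distinct) {suc i} {suc j} eq = cong suc (lookup-injective distinct eq)

  distinct⇒length≤ : ∀ {k} {xs : List (Fin k)} → AllPairs _≢_ xs → length xs ≤ k
  distinct⇒length≤ distinct = injective⇒≤ (lookup-injective distinct)

  ∃⊎∀ : ∀ {k} {P Q : Fin k → Set} → (∀ s → P s ⊎ Q s) → ∃ P ⊎ (∀ s → Q s)
  ∃⊎∀ {zero}  P⊎Q = inj₂ λ ()
  ∃⊎∀ {suc k} P⊎Q with P⊎Q zero | ∃⊎∀ (λ s → P⊎Q (suc s))
  ... | inj₁ p | _            = inj₁ (zero , p)
  ... | inj₂ _ | inj₁ (s , p) = inj₁ (suc s , p)
  ... | inj₂ q | inj₂ qs      = inj₂ λ { zero → q ; (suc s) → qs s }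

module Hall where

  open Finite
  open import Data.Nat as ℕ using (ℕ; zero; suc; _+_; _≤_; _<_; z≤n; s≤s)
  open import Data.Nat.Properties
    using (≤-trans; ≤-<-trans; <-irrefl; +-mono-≤; +-mono-<-≤; +-mono-≤-<; ≮⇒≥; +-suc; m+[n∸m]≡n; +-monoˡ-<; module ≤-Reasoning)
  open import Data.Nat.Induction using (<-wellFounded)
  open import Induction.WellFounded using (Acc; acc)
  open import Data.Fin using (Fin; zero; suc; _≟_)
  open import Data.Fin.Properties using (any?)
  open import Data.Fin.Subset
  open import Data.Fin.Subset.Properties
  open import Data.Product using (Σ; ∃; ∃₂; _×_; _,_; proj₁; proj₂)
  open import Data.Product.Properties using (≡-dec)
  open import Data.Sum using (_⊎_; inj₁; inj₂)
  open import Data.Empty using (⊥-elim)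
  open import Function using (_∘_; Injective)
  open import Relation.Nullary using (Dec; yes; no; ¬?; _×-dec_; contradiction)
  open import Relation.Binary.PropositionalEquality as ≡ using (_≡_; _≢_; refl; trans; cong; subst)

  private
    variable
      m n : ℕ

  neighbour? : (D : Fin m → Subset n) (A : Subset m) → ∀ j → Dec (∃ λ i → i ∈ A × j ∈ D i)
  neighbour? D A j = any? (λ i → i ∈? A ×-dec j ∈? D i)

  neighbours : (Fin m → Subset n) → Subset m → Subset n
  neighbours D A = fromDec (neighbour? D A)

  module _ (D : Fin m → Subset n) (A : Subset m) where

    ∈-neighbours⁺ : ∀ {i j} → i ∈ A → j ∈ D i → j ∈ neighbours D A
    ∈-neighbours⁺ {i} i∈A j∈Di = ∈-fromDec⁺ (neighbour? D A) (i , i∈A , j∈Di)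

    ∈-neighbours⁻ : ∀ {j} → j ∈ neighbours D A → ∃ λ i → i ∈ A × j ∈ D i
    ∈-neighbours⁻ = ∈-fromDec⁻ (neighbour? D A)

  HallCondition : (Fin m → Subset n) → Set
  HallCondition D = ∀ A → ∣ A ∣ ≤ ∣ neighbours D A ∣

  Deficient : (Fin m → Subset n) → Subset m → Set
  Deficient D A = ∣ neighbours D A ∣ < ∣ A ∣

  Matching : (Fin m → Subset n) → Set
  Matching {m} {n} D = Σ (Fin m → Fin n) λ g → (∀ i → g i ∈ D i) × Injective _≡_ _≡_ g

  hallCondition⊎deficient : (D : Fin m → Subset n) → HallCondition D ⊎ ∃ (Deficient D)
  hallCondition⊎deficient D with anySubset? (λ A → ∣ neighbours D A ∣ ℕ.<? ∣ A ∣)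
  ... | yes deficient = inj₂ deficient
  ... | no  ¬deficient = inj₁ (λ A → ≮⇒≥ (λ d → ¬deficient (A , d)))

  matching-mono : {D E : Fin m → Subset n} → (∀ i → E i ⊆ D i) → Matching E → Matching D
  matching-mono E⊆D (g , g∈E , g-injective) = g , (λ i → E⊆D i (g∈E i)) , g-injective

  Functional : (Fin m → Subset n) → Set
  Functional D = ∀ {i j j′} → j ∈ D i → j′ ∈ D i → j ≡ j′

  functional⊎branching : (D : Fin m → Subset n) →
    Functional D ⊎ ∃₂ λ x y₁ → ∃ λ y₂ → y₁ ∈ D x × y₂ ∈ D x × y₁ ≢ y₂
  functional⊎branching D
    with any? (λ x → any? (λ y₁ → any? (λ y₂ → y₁ ∈? D x ×-dec y₂ ∈? D x ×-dec ¬? (y₁ ≟ y₂))))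
  ... | yes (x , y₁ , y₂ , branch) = inj₂ (x , y₁ , y₂ , branch)
  ... | no  ¬branch = inj₁ functional
    where
    functional : Functional D
    functional {i} {j} {j′} j∈ j′∈ with j ≟ j′
    ... | yes j≡j′ = j≡j′
    ... | no  j≢j′ = ⊥-elim (¬branch (i , j , j′ , j∈ , j′∈ , j≢j′))

  module _ {D : Fin m → Subset n} (hall : HallCondition D) where

    nonempty-row : ∀ i → Nonempty (D i)
    nonempty-row i with ∣p∣>0⇒Nonempty _ (subst (_≤ ∣ neighbours D ⁅ i ⁆ ∣) (∣⁅x⁆∣≡1 i) (hall ⁅ i ⁆))
    ... | j , j∈N with ∈-neighbours⁻ D ⁅ i ⁆ j∈N
    ... | i′ , i′∈⁅i⁆ , j∈Di′ = j , subst (λ k → j ∈ D k) (x∈⁅y⁆⇒x≡y i i′∈⁅i⁆) j∈Di′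

    functional⇒matching : Functional D → Matching D
    functional⇒matching functional = g , g∈ , g-injective
      where
      g : Fin m → Fin n
      g i = proj₁ (nonempty-row i)
      g∈ : ∀ i → g i ∈ D i
      g∈ i = proj₂ (nonempty-row i)
      g-injective : Injective _≡_ _≡_ g
      g-injective {i} {i′} gi≡gi′ with i ≟ i′
      ... | yes i≡i′ = i≡i′
      ... | no  i≢i′ = contradiction (≤-trans ⁅i′⁆<A (≤-trans (hall A) NA≤1)) (<-irrefl refl)
        where
        A = ⁅ i ⁆ ∪ ⁅ i′ ⁆
        NA⊆⁅gi⁆ : neighbours D A ⊆ ⁅ g i ⁆
        NA⊆⁅gi⁆ j∈ with ∈-neighbours⁻ D A j∈
        ... | k , k∈A , j∈Dk with x∈p∪q⁻ ⁅ i ⁆ ⁅ i′ ⁆ k∈A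
        ... | inj₁ k∈⁅i⁆ rewrite x∈⁅y⁆⇒x≡y i k∈⁅i⁆ =
              subst (_∈ ⁅ g i ⁆) (functional (g∈ i) j∈Dk) (x∈⁅x⁆ (g i))
        ... | inj₂ k∈⁅i′⁆ rewrite x∈⁅y⁆⇒x≡y i′ k∈⁅i′⁆ =
              subst (_∈ ⁅ g i ⁆) (trans gi≡gi′ (functional (g∈ i′) j∈Dk)) (x∈⁅x⁆ (g i))
        NA≤1 : ∣ neighbours D A ∣ ≤ 1
        NA≤1 = subst (∣ neighbours D A ∣ ≤_) (∣⁅x⁆∣≡1 (g i)) (p⊆q⇒∣p∣≤∣q∣ NA⊆⁅gi⁆)
        ⁅i′⁆<A : 1 < ∣ A ∣
        ⁅i′⁆<A = subst (_< ∣ A ∣) (∣⁅x⁆∣≡1 i′)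
          (p⊂q⇒∣p∣<∣q∣ (q⊆p∪q ⁅ i ⁆ ⁅ i′ ⁆ , i , x∈p∪q⁺ (inj₁ (x∈⁅x⁆ i)) , x≢y⇒x∉⁅y⁆ i≢i′))

  _∖_ : (Fin m → Subset n) → Fin m × Fin n → Fin m → Subset n
  (D ∖ (x , y)) i with i ≟ x
  ... | yes _ = D i - y
  ... | no  _ = D i

  module _ (D : Fin m → Subset n) (x : Fin m) (y : Fin n) where

    ∖-⊆ : ∀ i → (D ∖ (x , y)) i ⊆ D i
    ∖-⊆ i with i ≟ x
    ... | yes _ = p─q⊆p (D i) ⁅ y ⁆
    ... | no  _ = λ j∈ → j∈

    ∈-∖⁺ : ∀ {i j} → j ∈ D i → (i , j) ≢ (x , y) → j ∈ (D ∖ (x , y)) i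
    ∈-∖⁺ {i} {j} j∈ ij≢xy with i ≟ x
    ... | yes refl = x∈p∧x≢y⇒x∈p-y j∈ (λ j≡y → ij≢xy (cong (x ,_) j≡y))
    ... | no  _    = j∈

    ∣∖∣<∣∣ : y ∈ D x → ∣ (D ∖ (x , y)) x ∣ < ∣ D x ∣
    ∣∖∣<∣∣ y∈ with x ≟ x
    ... | yes _   = x∈p⇒∣p-x∣<∣p∣ y∈
    ... | no  x≢x = contradiction refl x≢x

  edgeCount : (Fin m → Subset n) → ℕ
  edgeCount {zero}  D = 0
  edgeCount {suc m} D = ∣ D zero ∣ + edgeCount (D ∘ suc)

  edgeCount-mono-≤ : {D E : Fin m → Subset n} → (∀ i → ∣ E i ∣ ≤ ∣ D i ∣) → edgeCount E ≤ edgeCount D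
  edgeCount-mono-≤ {zero}  E≤D = z≤n
  edgeCount-mono-≤ {suc m} E≤D = +-mono-≤ (E≤D zero) (edgeCount-mono-≤ (E≤D ∘ suc))

  edgeCount-mono-< : {D E : Fin m → Subset n} → (∀ i → ∣ E i ∣ ≤ ∣ D i ∣) →
                     ∀ x → ∣ E x ∣ < ∣ D x ∣ → edgeCount E < edgeCount D
  edgeCount-mono-< E≤D zero    Ex<Dx = +-mono-<-≤ Ex<Dx (edgeCount-mono-≤ (E≤D ∘ suc))
  edgeCount-mono-< E≤D (suc x) Ex<Dx = +-mono-≤-< (E≤D zero) (edgeCount-mono-< (E≤D ∘ suc) x Ex<Dx)

  edgeCount-∖ : ∀ (D : Fin m → Subset n) {x y} → y ∈ D x → edgeCount (D ∖ (x , y)) < edgeCount D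
  edgeCount-∖ D {x} {y} y∈ = edgeCount-mono-< (λ i → p⊆q⇒∣p∣≤∣q∣ (∖-⊆ D x y i)) x (∣∖∣<∣∣ D x y y∈)

  module _ {D : Fin m → Subset n} (hall : HallCondition D) {x : Fin m} where

    deficient-∖⇒∈ : ∀ {y A} → Deficient (D ∖ (x , y)) A → x ∈ A
    deficient-∖⇒∈ {y} {A} deficient with x ∈? A
    ... | yes x∈A = x∈A
    ... | no  x∉A = contradiction (≤-<-trans (≤-trans (hall A) (p⊆q⇒∣p∣≤∣q∣ N⊆N∖)) deficient) (<-irrefl refl)
      where
      N⊆N∖ : neighbours D A ⊆ neighbours (D ∖ (x , y)) A
      N⊆N∖ j∈ with ∈-neighbours⁻ D A j∈
      ... | i , i∈A , j∈Di = ∈-neighbours⁺ (D ∖ (x , y)) A i∈A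
                               (∈-∖⁺ D x y j∈Di (λ ij≡xy → x∉A (subst (_∈ A) (cong proj₁ ij≡xy) i∈A)))

    -- Rado: the neighbourhoods of A₁ ∪ A₂ and (A₁ ∩ A₂) - x in D are covered by the union and
    -- intersection of the two deficient neighbourhoods, and submodularity of ∣_∣ does the rest.
    rado : ∀ {y₁ y₂} → y₁ ≢ y₂ → HallCondition (D ∖ (x , y₁)) ⊎ HallCondition (D ∖ (x , y₂))
    rado {y₁} {y₂} y₁≢y₂ with hallCondition⊎deficient (D ∖ (x , y₁)) | hallCondition⊎deficient (D ∖ (x , y₂))
    ... | inj₁ hall₁ | _          = inj₁ hall₁
    ... | inj₂ _     | inj₁ hall₂ = inj₂ hall₂
    ... | inj₂ (A₁ , deficient₁) | inj₂ (A₂ , deficient₂) = contradiction (≤-trans lower upper) (<-irrefl refl)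
      where
      D₁ = D ∖ (x , y₁)
      D₂ = D ∖ (x , y₂)
      X = neighbours D₁ A₁
      Y = neighbours D₂ A₂
      I = (A₁ ∩ A₂) - x
      x∈A₁ = deficient-∖⇒∈ deficient₁
      x∈A₂ = deficient-∖⇒∈ deficient₂

      N∪⊆ : neighbours D (A₁ ∪ A₂) ⊆ X ∪ Y
      N∪⊆ {j} j∈ with ∈-neighbours⁻ D (A₁ ∪ A₂) j∈
      ... | i , i∈ , j∈Di with (i , j) ≟ᵉ (x , y₁) | (i , j) ≟ᵉ (x , y₂)
        where _≟ᵉ_ = ≡-dec _≟_ _≟_
      ... | yes refl | _        = x∈p∪q⁺ (inj₂ (∈-neighbours⁺ D₂ A₂ x∈A₂ (∈-∖⁺ D x y₂ j∈Di (y₁≢y₂ ∘ cong proj₂))))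
      ... | no  ≢₁   | yes refl = x∈p∪q⁺ (inj₁ (∈-neighbours⁺ D₁ A₁ x∈A₁ (∈-∖⁺ D x y₁ j∈Di ≢₁)))
      ... | no  ≢₁   | no  ≢₂ with x∈p∪q⁻ A₁ A₂ i∈
      ...   | inj₁ i∈A₁ = x∈p∪q⁺ (inj₁ (∈-neighbours⁺ D₁ A₁ i∈A₁ (∈-∖⁺ D x y₁ j∈Di ≢₁)))
      ...   | inj₂ i∈A₂ = x∈p∪q⁺ (inj₂ (∈-neighbours⁺ D₂ A₂ i∈A₂ (∈-∖⁺ D x y₂ j∈Di ≢₂)))

      NI⊆ : neighbours D I ⊆ X ∩ Y
      NI⊆ j∈ with ∈-neighbours⁻ D I j∈
      ... | i , i∈I , j∈Di with x∈p∩q⁻ A₁ A₂ (p─q⊆p _ _ i∈I)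
      ...   | i∈A₁ , i∈A₂ = x∈p∩q⁺ (∈-neighbours⁺ D₁ A₁ i∈A₁ (∈-∖⁺ D x y₁ j∈Di (i≢x ∘ cong proj₁)) ,
                                    ∈-neighbours⁺ D₂ A₂ i∈A₂ (∈-∖⁺ D x y₂ j∈Di (i≢x ∘ cong proj₁)))
        where i≢x = x∈p-y⇒x≢y (A₁ ∩ A₂) i∈I

      upper : ∣ A₁ ∣ + ∣ A₂ ∣ ≤ suc (∣ X ∣ + ∣ Y ∣)
      upper = begin
        ∣ A₁ ∣ + ∣ A₂ ∣                        ≡⟨ ≡.sym (∣p∪q∣+∣p∩q∣≡∣p∣+∣q∣ A₁ A₂) ⟩
        ∣ A₁ ∪ A₂ ∣ + ∣ A₁ ∩ A₂ ∣              ≤⟨ +-mono-≤ (hall (A₁ ∪ A₂)) (∣p∣≤1+∣p-x∣ (A₁ ∩ A₂) x) ⟩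
        ∣ neighbours D (A₁ ∪ A₂) ∣ + suc ∣ I ∣ ≤⟨ +-mono-≤ (p⊆q⇒∣p∣≤∣q∣ N∪⊆)
                                                            (s≤s (≤-trans (hall I) (p⊆q⇒∣p∣≤∣q∣ NI⊆))) ⟩
        ∣ X ∪ Y ∣ + suc ∣ X ∩ Y ∣              ≡⟨ +-suc _ _ ⟩
        suc (∣ X ∪ Y ∣ + ∣ X ∩ Y ∣)            ≡⟨ cong suc (∣p∪q∣+∣p∩q∣≡∣p∣+∣q∣ X Y) ⟩
        suc (∣ X ∣ + ∣ Y ∣)                    ∎
        where open ≤-Reasoning

      lower : suc (suc (∣ X ∣ + ∣ Y ∣)) ≤ ∣ A₁ ∣ + ∣ A₂ ∣
      lower = subst (_≤ ∣ A₁ ∣ + ∣ A₂ ∣) (cong suc (+-suc _ _)) (+-mono-≤ deficient₁ deficient₂)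

  -- Induction on the number of edges: while some row has two elements, one of its two edges can be
  -- deleted without breaking Hall's condition.
  hall-theorem : (D : Fin m → Subset n) → HallCondition D → Matching D
  hall-theorem D = go D (<-wellFounded (edgeCount D))
    where
    go : ∀ D → Acc _<_ (edgeCount D) → HallCondition D → Matching D
    go D (acc smaller) hall with functional⊎branching D
    ... | inj₁ functional = functional⇒matching hall functional
    ... | inj₂ (x , y₁ , y₂ , y₁∈ , y₂∈ , y₁≢y₂) with rado hall y₁≢y₂
    ...   | inj₁ hall₁ = matching-mono (∖-⊆ D x y₁) (go _ (smaller (edgeCount-∖ D y₁∈)) hall₁)
    ...   | inj₂ hall₂ = matching-mono (∖-⊆ D x y₂) (go _ (smaller (edgeCount-∖ D y₂∈)) hall₂)

  record LargeRectangle (m n : ℕ) : Set where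
    field
      rows  : Subset m
      cols  : Subset n
      large : n < ∣ rows ∣ + ∣ cols ∣
  open LargeRectangle public

  -- König's form of Hall's theorem: rows A and cols ∁ (neighbours D A) for a deficient A.
  matching⊎emptyRectangle : (D : Fin m → Subset n) →
    Matching D ⊎ Σ (LargeRectangle m n) λ R → ∀ {i j} → i ∈ rows R → j ∈ cols R → j ∉ D i
  matching⊎emptyRectangle {n = n} D with hallCondition⊎deficient D
  ... | inj₁ hall = inj₁ (hall-theorem D hall)
  ... | inj₂ (A , deficient) = inj₂ (R , λ i∈A j∈C j∈Di → x∈∁p⇒x∉p j∈C (∈-neighbours⁺ D A i∈A j∈Di))
    where
    N = neighbours D A
    R : LargeRectangle _ n
    R = record
      { rows  = A
      ; cols  = ∁ N
      ; large = begin-strict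
          n                          ≡⟨ ≡.sym (m+[n∸m]≡n (∣p∣≤n N)) ⟩
          ∣ N ∣ + (n ℕ.∸ ∣ N ∣)      <⟨ +-monoˡ-< _ deficient ⟩
          ∣ A ∣ + (n ℕ.∸ ∣ N ∣)      ≡⟨ cong (∣ A ∣ +_) (≡.sym (∣∁p∣≡n∸∣p∣ N)) ⟩
          ∣ A ∣ + ∣ ∁ N ∣            ∎
      }
      where open ≤-Reasoning

module Walks where

  open import Data.Nat using (ℕ; zero; suc; _+_; _≤_; z≤n; s≤s)
  open import Data.Nat.Properties using (n<1+n; +-suc; m≤n⇒∃[o]m+o≡n)
  open import Data.Nat.GeneralisedArithmetic using (iterate)
  open import Data.Fin using (Fin; toℕ; _≟_)
  open import Data.Fin.Properties using (pigeonhole)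
  open import Data.List using (List; []; _∷_; _∷ʳ_; length)
  open import Data.List.Membership.Propositional using (_∈_)
  import Data.List.Membership.DecPropositional as DecMembership
  open import Data.List.Relation.Unary.Any using (here; there)
  open import Data.List.Relation.Unary.All as All using (All; []; _∷_)
  open import Data.List.Relation.Unary.All.Properties using (¬Any⇒All¬)
  open import Data.List.Relation.Unary.AllPairs using (AllPairs; []; _∷_)
  open import Data.List.Relation.Unary.Linked using (Linked; [-]; _∷_)
  open import Data.Product using (Σ; ∃; ∃₂; _×_; _,_; proj₁; proj₂)
  open import Data.Sum using (_⊎_; inj₁; inj₂)
  open import Data.Unit using (tt) renaming (⊤ to Unit)
  open import Data.Empty using (⊥; ⊥-elim)
  open import Relation.Nullary using (¬_; yes; no; contradiction)
  open import Relation.Unary using (Satisfiable; _≬_)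
  open import Relation.Binary.PropositionalEquality as ≡ using (_≡_; _≢_; refl; trans; cong; subst)

  module _ {k : ℕ} where

    open DecMembership (_≟_ {k}) using (_∈?_)

    private
      variable
        A B R T : Fin k → Fin k → Set
        P Q : Fin k → Set
        a b c d : Fin k

    nodes : WalkIn A P a b → List (Fin k)
    nodes (here {a} _)      = a ∷ []
    nodes (there {a} _ _ W) = a ∷ nodes W

    head∈nodes : (W : WalkIn A P a b) → a ∈ nodes W
    head∈nodes (here _)      = here refl
    head∈nodes (there _ _ _) = here refl

    last∈nodes : (W : WalkIn A P a b) → b ∈ nodes W
    last∈nodes (here _)      = here refl
    last∈nodes (there _ _ W) = there (last∈nodes W)

    ∈-nodes⇒P : (W : WalkIn A P a b) → ∀ {x} → x ∈ nodes W → P x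
    ∈-nodes⇒P (here p)      (here refl) = p
    ∈-nodes⇒P (there p _ _) (here refl) = p
    ∈-nodes⇒P (there _ _ W) (there x∈)  = ∈-nodes⇒P W x∈

    Simple : WalkIn A P a b → Set
    Simple W = AllPairs _≢_ (nodes W)

    mapʷ : (∀ {x} → P x → Q x) → WalkIn A P a b → WalkIn A Q a b
    mapʷ f (here p)      = here (f p)
    mapʷ f (there p e W) = there (f p) e (mapʷ f W)

    head-P : WalkIn A P a b → P a
    head-P (here p)      = p
    head-P (there p _ _) = p

    mapStep : (∀ {x y} → P x → A x y → P y → B x y) → WalkIn A P a b → WalkIn B P a b
    mapStep f (here p)      = here p
    mapStep f (there p e W) = there p (f p e (head-P W)) (mapStep f W)

    _++ʷ_ : WalkIn A P a b → WalkIn A P b c → WalkIn A P a c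
    here _      ++ʷ V = V
    there p e W ++ʷ V = there p e (W ++ʷ V)

    _∷ʳʷ_ : WalkIn A P a b → A b c × P c → WalkIn A P a c
    here p      ∷ʳʷ (e , q) = there p e (here q)
    there p e W ∷ʳʷ step    = there p e (W ∷ʳʷ step)

    reverseʷ : (∀ {x y} → A x y → A y x) → WalkIn A P a b → WalkIn A P b a
    reverseʷ A-sym (here p)      = here p
    reverseʷ A-sym (there p e W) = reverseʷ A-sym W ∷ʳʷ (A-sym e , p)

    onNodes : (W : WalkIn A P a b) → WalkIn A (_∈ nodes W) a b
    onNodes (here _)      = here (here refl)
    onNodes (there _ e W) = there (here refl) e (mapʷ there (onNodes W))

    suffix : (W : WalkIn A P a b) → c ∈ nodes W → WalkIn A P c b
    suffix W@(here _)      (here refl) = W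
    suffix W@(there _ _ _) (here refl) = W
    suffix (there _ _ W)   (there c∈)  = suffix W c∈

    suffix-⊆ : (W : WalkIn A P a b) (c∈ : c ∈ nodes W) → ∀ {x} → x ∈ nodes (suffix W c∈) → x ∈ nodes W
    suffix-⊆ (here _)      (here refl) x∈ = x∈
    suffix-⊆ (there _ _ _) (here refl) x∈ = x∈
    suffix-⊆ (there _ _ W) (there c∈)  x∈ = there (suffix-⊆ W c∈ x∈)

    suffix-simple : (W : WalkIn A P a b) (c∈ : c ∈ nodes W) → Simple W → Simple (suffix W c∈)
    suffix-simple (here _)      (here refl) simple       = simple
    suffix-simple (there _ _ _) (here refl) simple       = simple
    suffix-simple (there _ _ W) (there c∈)  (_ ∷ simple) = suffix-simple W c∈ simple

    simplify : WalkIn A P a b → Σ (WalkIn A P a b) Simple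
    simplify (here p) = here p , [] ∷ []
    simplify {a = a} (there p e W) with simplify W
    ... | W′ , simple with a ∈? nodes W′
    ...   | yes a∈ = suffix W′ a∈ , suffix-simple W′ a∈ simple
    ...   | no  a∉ = there p e W′ , ¬Any⇒All¬ (nodes W′) a∉ ∷ simple

    step-away : WalkIn A P a b → a ≢ b → ∃ λ c → A a c × WalkIn A (_≢ a) c b
    step-away W a≢b with simplify W
    ... | here _ , _              = contradiction refl a≢b
    ... | there _ e W′ , a∉W′ ∷ _ = _ , e , mapʷ (λ x∈ x≡a → All.lookup a∉W′ x∈ (≡.sym x≡a)) (onNodes W′)

    IsSubtree : (Fin k → Fin k → Set) → (Fin k → Set) → Set
    IsSubtree T Y = Satisfiable Y × (∀ {x y} → Y x → Y y → WalkIn T Y x y)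

    module _ (tree : IsTree k T) where
      open IsTree tree using (connected; acyclic)

      private
        closed-linked : (∀ {x y} → R x y → T x y) → (W : WalkIn R P a b) → T b c →
                        Linked T (nodes W ∷ʳ c)
        closed-linked R⊆T (here _)                    bc = bc ∷ [-]
        closed-linked R⊆T (there _ e (here _))        bc = R⊆T e ∷ bc ∷ [-]
        closed-linked R⊆T (there _ e W@(there _ _ _)) bc = R⊆T e ∷ closed-linked R⊆T W bc

        1≤length : (W : WalkIn A P a b) → 1 ≤ length (nodes W)
        1≤length (here _)      = s≤s z≤n
        1≤length (there _ _ _) = s≤s z≤n

      -- A simple walk from a to a neighbour b of a is the edge itself: anything longer closes a cycle.
      simple-walk-to-neighbour : (∀ {x y} → R x y → T x y) → (W : WalkIn R P a b) → Simple W →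
                                 T b a → a ≡ b ⊎ R a b
      simple-walk-to-neighbour R⊆T (here _)             _      _  = inj₁ refl
      simple-walk-to-neighbour R⊆T (there _ e (here _)) _      _  = inj₂ e
      simple-walk-to-neighbour {a = a} R⊆T W@(there _ _ W′@(there _ _ W″)) simple ba =
        ⊥-elim (acyclic a (nodes W′) (s≤s (1≤length W″)) simple (closed-linked R⊆T W ba))

      -- The two walks combine into a walk from b to a that never steps from b to a, so closing it
      -- with the edge a b would give a cycle.
      edge-separates : T a b → WalkIn T (_≢ a) b d → WalkIn T (_≢ b) a d → ⊥
      edge-separates {a} {b} {d} ab from-b from-a with simplify (to-d ++ʷ from-d)
        where
        NotBA : Fin k → Fin k → Set
        NotBA x y = T x y × ¬ (x ≡ b × y ≡ a)
        to-d : WalkIn NotBA (λ _ → Unit) b d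
        to-d = mapʷ (λ _ → tt) (mapStep (λ _ e y≢a → e , λ (_ , y≡a) → y≢a y≡a) from-b)
        from-d : WalkIn NotBA (λ _ → Unit) d a
        from-d = mapʷ (λ _ → tt) (mapStep (λ x≢b e _ → e , λ (x≡b , _) → x≢b x≡b) (reverseʷ (IsTree.sym tree) from-a))
      ... | W , simple with simple-walk-to-neighbour proj₁ W simple ab
      ...   | inj₁ refl      = IsTree.irrefl tree ab
      ...   | inj₂ (_ , ¬ba) = ¬ba (refl , refl)

      -- Iterating f from x₀ must revisit a node; the f-walk from f y back to y then closes up with
      -- the edge y → f y, so it is that edge reversed.
      two-cycle : (f : Fin k → Fin k) → (∀ x → T x (f x)) → Fin k → ∃ λ x → f (f x) ≡ x
      two-cycle f x-fx x₀
        with i , j , i<j , fⁱ≡fʲ ← pigeonhole (n<1+n k) (λ r → iterate f x₀ (toℕ r))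
        with o , i+1+o≡j ← m≤n⇒∃[o]m+o≡n i<j
        = y , to-neighbour (simplify f-walk)
        where
        y = iterate f x₀ (toℕ i)
        iterate-+ : ∀ x r l → iterate f x (r + l) ≡ iterate f (iterate f x r) l
        iterate-+ x zero    l = refl
        iterate-+ x (suc r) l = iterate-+ (f x) r l
        f-path : ∀ x r → WalkIn (λ u v → f u ≡ v) (λ _ → Unit) x (iterate f x r)
        f-path x zero    = here tt
        f-path x (suc r) = there tt refl (f-path (f x) r)
        returns : iterate f (f y) o ≡ y
        returns = begin
          iterate f (f y) o            ≡⟨ ≡.sym (iterate-+ x₀ (toℕ i) (suc o)) ⟩
          iterate f x₀ (toℕ i + suc o) ≡⟨ cong (iterate f x₀) (trans (+-suc (toℕ i) o) i+1+o≡j) ⟩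
          iterate f x₀ (toℕ j)         ≡⟨ ≡.sym fⁱ≡fʲ ⟩
          y                            ∎
          where open ≡.≡-Reasoning
        f-walk : WalkIn (λ u v → f u ≡ v) (λ _ → Unit) (f y) y
        f-walk = subst (WalkIn _ _ (f y)) returns (f-path (f y) o)
        to-neighbour : Σ (WalkIn (λ u v → f u ≡ v) (λ _ → Unit) (f y) y) Simple → f (f y) ≡ y
        to-neighbour (W , simple)
          with simple-walk-to-neighbour (λ {u} fu≡v → subst (T u) fu≡v (x-fx u)) W simple (x-fx y)
        ... | inj₁ fy≡y = ⊥-elim (IsTree.irrefl tree (subst (T y) fy≡y (x-fx y)))
        ... | inj₂ ffy≡y = ffy≡y

      -- Helly's property for subtrees, in the form needed: point every node s towards its subtree
      -- Y s; two nodes pointing at each other carry subtrees on opposite sides of their edge.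
      module _ (Y : Fin k → Fin k → Set) (subtree : ∀ s → IsSubtree T (Y s)) (avoid : ∀ s → ¬ Y s s) where
        private
          root : Fin k → Fin k
          root s = proj₁ (proj₁ (subtree s))
          root∈ : ∀ s → Y s (root s)
          root∈ s = proj₂ (proj₁ (subtree s))
          ≢-index : ∀ s {x} → Y s x → x ≢ s
          ≢-index s x∈ refl = avoid s x∈
          exit : ∀ s → ∃ λ c → T s c × WalkIn T (_≢ s) c (root s)
          exit s = step-away (connected s (root s)) (λ s≡root → ≢-index s (root∈ s) (≡.sym s≡root))
          f : Fin k → Fin k
          f s = proj₁ (exit s)
          towards : ∀ s → T s (f s)
          towards s = proj₁ (proj₂ (exit s))
          path : ∀ s {x} → Y s x → WalkIn T (_≢ s) (f s) x
          path s x∈ = proj₂ (proj₂ (exit s)) ++ʷ mapʷ (≢-index s) (proj₂ (subtree s) (root∈ s) x∈)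

        avoiding-subtrees⇒disjoint : Fin k → ∃₂ λ a b → ¬ (Y a ≬ Y b)
        avoiding-subtrees⇒disjoint s₀ with a , ffa≡a ← two-cycle f towards s₀ =
          a , f a , λ (x , x∈Ya , x∈Yfa) →
            edge-separates (towards a) (path a x∈Ya) (subst (λ z → WalkIn T (_≢ f a) z x) ffa≡a (path (f a) x∈Yfa))

module TreeDecompositions where

  open Walks
  open import Data.Fin using (Fin; zero; _≟_)
  open import Data.List using (List; []; _∷_; concatMap)
  open import Data.List.Membership.Propositional using (_∈_; find; lose)
  open import Data.List.Membership.Propositional.Properties using (∈-concatMap⁺)
  import Data.List.Membership.DecPropositional as DecMembership
  open import Data.List.Relation.Unary.Any as Any using (Any; here; there)
  open import Data.List.Relation.Unary.All as All using ()
  open import Data.List.Relation.Unary.Linked using (_∷_)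
  open import Data.Product using (∃; _×_; _,_; proj₁; proj₂)
  open import Data.Sum using (_⊎_; inj₁; inj₂)
  open import Data.Unit using (tt) renaming (⊤ to Unit)
  open import Data.Empty using () renaming (⊥ to Empty)
  open import Relation.Nullary using (Dec; yes; no; contradiction)
  open import Relation.Binary.PropositionalEquality as ≡ using (_≡_; refl; subst)

  module _ {G : Graph} where

    IsIndep-mono : ∀ {S S′ : V G → Set} {xs} → (∀ {v} → S v → S′ v) → IsIndep G S xs → IsIndep G S′ xs
    IsIndep-mono S⊆S′ (distinct , inS , independent) = distinct , All.map S⊆S′ inS , independent

    Touched : (D : TreeDecomposition G) → (V G → Set) → Fin (t D) → Set
    Touched D S s = ∃ λ v → S v × bag D s v

    common-bag : (D : TreeDecomposition G) → ∀ {v w} → v ≡ w ⊎ Adj G v w → ∃ λ s → bag D s v × bag D s w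
    common-bag D {v} (inj₁ refl) = proj₁ (cover D v) , proj₂ (cover D v) , proj₂ (cover D v)
    common-bag D     (inj₂ vw)   = edge D _ _ vw

    touched-walk : (D : TreeDecomposition G) {S : V G → Set} → ∀ {v w x y} → S v → S w →
                   v ≡ w ⊎ Adj G v w → bag D x v → bag D y w → WalkIn (TAdj D) (Touched D S) x y
    touched-walk D {v = v} {w} v∈S w∈S vw x∋v y∋w with common-bag D vw
    ... | z , z∋v , z∋w = mapʷ (λ s∋v → v , v∈S , s∋v) (subtree D v _ z x∋v z∋v)
                       ++ʷ mapʷ (λ s∋w → w , w∈S , s∋w) (subtree D w z _ z∋w y∋w)

  -- Bags are arbitrary predicates, but Hall's theorem needs decidable ones.  A refined bag keeps v
  -- only at the nodes of walks, inside the original subtree of v, from an anchor of v to a fixed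
  -- root; the anchors are the cover node of v and, for each edge at v, a node covering that edge.
  module Refinement {G : Graph} (vertices : List (V G)) (complete : ∀ v → v ∈ vertices)
                    (adj? : ∀ u v → Dec (Adj G u v)) (D : TreeDecomposition G) where

    private
      Anchor : V G → Set
      Anchor v = ∃ λ s → bag D s v

      anchorˡ : ∀ u w → Dec (Adj G u w) → Anchor u
      anchorˡ u w (yes uw) = proj₁ (edge D u w uw) , proj₁ (proj₂ (edge D u w uw))
      anchorˡ u w (no _)   = cover D u

      anchorʳ : ∀ u w → Dec (Adj G u w) → Anchor w
      anchorʳ u w (yes uw) = proj₁ (edge D u w uw) , proj₂ (proj₂ (edge D u w uw))
      anchorʳ u w (no _)   = cover D w

      anchorˡ≡anchorʳ : ∀ {u w} → Adj G u w → (d : Dec (Adj G u w)) →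
                        proj₁ (anchorˡ u w d) ≡ proj₁ (anchorʳ u w d)
      anchorˡ≡anchorʳ uw (yes _)  = refl
      anchorˡ≡anchorʳ uw (no ¬uw) = contradiction uw ¬uw

      edge-anchors : ∀ v → V G → List (Anchor v)
      edge-anchors v u = anchorˡ v u (adj? v u) ∷ anchorʳ u v (adj? u v) ∷ []

      anchors : ∀ v → List (Anchor v)
      anchors v = cover D v ∷ concatMap (edge-anchors v) vertices

      root : V G → Fin (t D)
      root v = proj₁ (cover D v)

      path : ∀ v (a : Anchor v) → WalkIn (TAdj D) (λ s → bag D s v) (proj₁ a) (root v)
      path v (s , s∋v) = subtree D v s (root v) s∋v (proj₂ (cover D v))

      refined-bag : Fin (t D) → V G → Set
      refined-bag s v = Any (λ a → s ∈ nodes (path v a)) (anchors v)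

      to-root : ∀ {s v} → refined-bag s v → WalkIn (TAdj D) (λ s → refined-bag s v) s (root v)
      to-root {s} {v} s∈ with find s∈
      ... | a , a∈ , s∈path =
        mapʷ (λ x∈ → lose a∈ (suffix-⊆ (path v a) s∈path x∈)) (onNodes (suffix (path v a) s∈path))

      edge-anchor∈ : ∀ {v w} → Adj G v w →
        let s = proj₁ (anchorˡ v w (adj? v w)) in refined-bag s v × refined-bag s w
      edge-anchor∈ {v} {w} vw =
        lose (there (∈-concatMap⁺ (edge-anchors v) (lose (complete w) (here refl))))
             (head∈nodes (path v _)) ,
        lose (there (∈-concatMap⁺ (edge-anchors w) (lose (complete v) (there (here refl)))))
             (subst (λ s → s ∈ nodes (path w (anchorʳ v w (adj? v w))))
                    (≡.sym (anchorˡ≡anchorʳ vw (adj? v w))) (head∈nodes (path w _)))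

    refine : TreeDecomposition G
    refine = record
      { t       = t D
      ; TAdj    = TAdj D
      ; isTree  = isTree D
      ; bag     = refined-bag
      ; cover   = λ v → root v , here (last∈nodes (path v (cover D v)))
      ; edge    = λ v w vw → _ , edge-anchor∈ vw
      ; subtree = λ v a b a∈ b∈ → to-root a∈ ++ʷ reverseʷ (IsTree.sym (isTree D)) (to-root b∈)
      }

    refine-bag? : ∀ s v → Dec (bag refine s v)
    refine-bag? s v = Any.any? (λ a → s ∈? nodes (path v a)) (anchors v)
      where open DecMembership (_≟_ {t D}) using (_∈?_)

    refine-⊆ : ∀ {s v} → bag refine s v → bag D s v
    refine-⊆ {s} {v} s∈ with find s∈
    ... | a , _ , s∈path = ∈-nodes⇒P (path v a) s∈path

  trivialDecomposition : (G : Graph) → TreeDecomposition G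
  trivialDecomposition G = record
    { t       = 1
    ; TAdj    = λ _ _ → Empty
    ; isTree  = record
      { sym       = λ ()
      ; irrefl    = λ ()
      ; connected = λ { zero zero → here tt }
      ; acyclic   = λ { _ (_ ∷ _) _ _ (() ∷ _) }
      }
    ; bag     = λ _ _ → Unit
    ; cover   = λ _ → zero , tt
    ; edge    = λ _ _ _ → zero , tt , tt
    ; subtree = λ { _ zero zero _ _ → here tt }
    }

module LineGraph where

  open Finite
  open Hall
  open Walks
  open TreeDecompositions
  open import Data.Nat using (ℕ; zero; suc; _+_; _≤_; _<_; z≤n; s≤s)
  open import Data.Nat.Properties
    using (≤-trans; <-≤-trans; +-comm; <-irrefl; ≤-reflexive; +-mono-≤; +-mono-<; +-commutativeSemigroup; module ≤-Reasoning)
  open import Algebra.Properties.CommutativeSemigroup +-commutativeSemigroup using (interchange)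
  open import Data.Fin using (Fin; _≟_)
  open import Data.Fin.Subset using (Subset; _∈_; _∩_; ∣_∣; Nonempty)
  open import Data.Fin.Subset.Properties using (∣p∣≤n; nonempty?; x∈p∩q⁻)
  open import Data.List using (List; length; tabulate; allFin; cartesianProduct)
  open import Data.List.Properties using (length-tabulate; length-map)
  import Data.List.Membership.Propositional as List
  open import Data.List.Membership.Propositional.Properties using (∈-allFin; ∈-cartesianProduct⁺)
  import Data.List.Relation.Unary.All.Properties as All
  import Data.List.Relation.Unary.AllPairs as AllPairs
  import Data.List.Relation.Unary.AllPairs.Properties as AllPairs
  open import Data.Product using (Σ; ∃; ∃₂; _×_; _,_; proj₁; proj₂)
  open import Data.Product.Properties using (≡-dec)
  open import Data.Sum using (_⊎_; inj₁; inj₂)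
  open import Function using (_∘′_; Injective)
  open import Relation.Nullary using (¬_; Dec; yes; no; ¬?; _×-dec_; _⊎-dec_; contradiction)
  open import Relation.Unary using (Satisfiable; _≬_)
  open import Relation.Binary.PropositionalEquality as ≡ using (_≡_; refl; cong; subst)

  module _ {m n : ℕ} where

    vertices : List (Fin m × Fin n)
    vertices = cartesianProduct (allFin m) (allFin n)

    ∈-vertices : ∀ v → v List.∈ vertices
    ∈-vertices (i , j) = ∈-cartesianProduct⁺ (∈-allFin i) (∈-allFin j)

    LAdj? : ∀ u v → Dec (LAdj m n u v)
    LAdj? (i , j) (i′ , j′) = ¬? (≡-dec _≟_ _≟_ (i , j) (i′ , j′)) ×-dec (i ≟ i′ ⊎-dec j ≟ j′)

    ≡⊎LAdj : ∀ {i i′ j j′} → i ≡ i′ ⊎ j ≡ j′ → (i , j) ≡ (i′ , j′) ⊎ LAdj m n (i , j) (i′ , j′)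
    ≡⊎LAdj {i} {i′} {j} {j′} shared with ≡-dec _≟_ _≟_ (i , j) (i′ , j′)
    ... | yes ij≡i′j′ = inj₁ ij≡i′j′
    ... | no  ij≢i′j′ = inj₂ (ij≢i′j′ , shared)

    α≤m : ∀ (S : Fin m × Fin n → Set) → αLe (LKmn m n) S m
    α≤m S xs (distinct , _ , independent) = subst (_≤ m) (length-map proj₁ xs)
      (distinct⇒length≤ (AllPairs.map⁺
        (AllPairs.zipWith (λ (u≢v , ¬uv) i≡i′ → ¬uv (u≢v , inj₁ i≡i′)) (distinct , independent))))

    graph-independent : ∀ {S : Fin m × Fin n → Set} (g : Fin m → Fin n) → Injective _≡_ _≡_ g →
                        (∀ i → S (i , g i)) → IsIndep (LKmn m n) S (tabulate (λ i → i , g i))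
    graph-independent g g-injective S-graph =
      AllPairs.tabulate⁺ (λ i≢j → i≢j ∘′ cong proj₁) ,
      All.tabulate⁺ S-graph ,
      AllPairs.tabulate⁺ λ { i≢j (_ , inj₁ i≡j) → i≢j i≡j ; i≢j (_ , inj₂ gi≡gj) → i≢j (g-injective gi≡gj) }

    InRectangle : LargeRectangle m n → Fin m × Fin n → Set
    InRectangle R (i , j) = i ∈ rows R × j ∈ cols R

    private
      positive : ∀ {a c} → n < a + c → c ≤ n → 0 < a
      positive {zero}  n<c c≤n = contradiction (<-≤-trans n<c c≤n) (<-irrefl refl)
      positive {suc a} _   _   = s≤s z≤n

    nonempty-rows : (R : LargeRectangle m n) → Nonempty (rows R)
    nonempty-rows R = ∣p∣>0⇒Nonempty (rows R) (positive (large R) (∣p∣≤n (cols R)))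

    nonempty-cols : m ≤ n → (R : LargeRectangle m n) → Nonempty (cols R)
    nonempty-cols m≤n R = ∣p∣>0⇒Nonempty (cols R)
      (positive (subst (n <_) (+-comm ∣ rows R ∣ _) (large R)) (≤-trans (∣p∣≤n (rows R)) m≤n))

    -- Two large rectangles share a row or a column, for otherwise their rows and columns
    -- would number at most m + n ≤ 2n in total.
    rectangles-touch : m ≤ n → (R R′ : LargeRectangle m n) →
      ∃₂ λ v w → InRectangle R v × InRectangle R′ w × (v ≡ w ⊎ LAdj m n v w)
    rectangles-touch m≤n R R′ with nonempty? (rows R ∩ rows R′) | nonempty? (cols R ∩ cols R′)
    ... | yes (i , i∈) | _ =
      let i∈R , i∈R′ = x∈p∩q⁻ (rows R) (rows R′) i∈
          j , j∈ = nonempty-cols m≤n R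
          j′ , j′∈ = nonempty-cols m≤n R′
      in (i , j) , (i , j′) , (i∈R , j∈) , (i∈R′ , j′∈) , ≡⊎LAdj (inj₁ refl)
    ... | no _ | yes (j , j∈) =
      let j∈R , j∈R′ = x∈p∩q⁻ (cols R) (cols R′) j∈
          i , i∈ = nonempty-rows R
          i′ , i′∈ = nonempty-rows R′
      in (i , j) , (i′ , j) , (i∈ , j∈R) , (i′∈ , j∈R′) , ≡⊎LAdj (inj₂ refl)
    ... | no rows-disjoint | no cols-disjoint = contradiction too-large (<-irrefl refl)
      where
      a = ∣ rows R ∣ ; a′ = ∣ rows R′ ∣ ; c = ∣ cols R ∣ ; c′ = ∣ cols R′ ∣
      too-large : n + n < n + n
      too-large = begin-strict
        n + n               <⟨ +-mono-< (large R) (large R′) ⟩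
        (a + c) + (a′ + c′) ≡⟨ interchange a c a′ c′ ⟩
        (a + a′) + (c + c′) ≤⟨ +-mono-≤ (≤-trans (Empty[p∩q]⇒∣p∣+∣q∣≤n (rows R) (rows R′) rows-disjoint) m≤n)
                                        (Empty[p∩q]⇒∣p∣+∣q∣≤n (cols R) (cols R′) cols-disjoint) ⟩
        n + n               ∎
        where open ≤-Reasoning

    LargeIndependentSet : (Fin m × Fin n → Set) → Set
    LargeIndependentSet S = Σ (List (Fin m × Fin n)) λ xs → IsIndep (LKmn m n) S xs × m ≤ length xs

    module _ (m≤n : m ≤ n) (D : TreeDecomposition (LKmn m n)) where

      rectangle-subtree : (R : LargeRectangle m n) → IsSubtree (TAdj D) (Touched D (InRectangle R))
      rectangle-subtree R =
        let v , v∈R = first-vertex in (proj₁ (cover D v) , v , v∈R , proj₂ (cover D v)) ,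
        λ { ((i , j) , (i∈ , j∈) , x∋v) ((i′ , j′) , (i′∈ , j′∈) , y∋w) →
              touched-walk D (i∈ , j∈) (i∈ , j′∈) (≡⊎LAdj (inj₁ refl)) x∋v (proj₂ (cover D (i , j′)))
          ++ʷ touched-walk D (i∈ , j′∈) (i′∈ , j′∈) (≡⊎LAdj (inj₂ refl)) (proj₂ (cover D (i , j′))) y∋w }
        where
        first-vertex : Satisfiable (InRectangle R)
        first-vertex = let i , i∈ = nonempty-rows R ; j , j∈ = nonempty-cols m≤n R in (i , j) , i∈ , j∈

      rectangles-meet : (R R′ : LargeRectangle m n) → Touched D (InRectangle R) ≬ Touched D (InRectangle R′)
      rectangles-meet R R′ with rectangles-touch m≤n R R′
      ... | v , w , v∈R , w∈R′ , v~w with common-bag D v~w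
      ...   | s , s∋v , s∋w = s , (v , v∈R , s∋v) , (w , w∈R′ , s∋w)

      module _ (bag? : ∀ s v → Dec (bag D s v)) where

        bipartite : Fin (t D) → Fin m → Subset n
        bipartite s i = fromDec (λ j → bag? s (i , j))

        independent⊎avoids : ∀ s → LargeIndependentSet (bag D s) ⊎
                                   Σ (LargeRectangle m n) λ R → ¬ Touched D (InRectangle R) s
        independent⊎avoids s with matching⊎emptyRectangle (bipartite s)
        ... | inj₁ (g , g∈ , g-injective) = inj₁
              (_ , graph-independent g g-injective (λ i → ∈-fromDec⁻ (λ j → bag? s (i , j)) (g∈ i)) ,
               ≤-reflexive (≡.sym (length-tabulate _)))
        ... | inj₂ (R , empty) = inj₂
              (R , λ { ((i , j) , (i∈ , j∈) , s∋ij) → empty i∈ j∈ (∈-fromDec⁺ (λ j → bag? s (i , j)) s∋ij) })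

        no-avoiding-family : Fin (t D) → ¬ (∀ s → Σ (LargeRectangle m n) λ R → ¬ Touched D (InRectangle R) s)
        no-avoiding-family s₀ avoided =
          let a , b , disjoint = avoiding-subtrees⇒disjoint (isTree D) (λ s → Touched D (InRectangle (R s)))
                                   (λ s → rectangle-subtree (R s)) (λ s → proj₂ (avoided s)) s₀
          in disjoint (rectangles-meet (R a) (R b))
          where
          R : Fin (t D) → LargeRectangle m n
          R s = proj₁ (avoided s)

        decidable-lower-bound : Fin (t D) → ∃ λ s → LargeIndependentSet (bag D s)
        decidable-lower-bound s₀ with ∃⊎∀ independent⊎avoids
        ... | inj₁ found   = found
        ... | inj₂ avoided = contradiction avoided (no-avoiding-family s₀)

    open Refinement {G = LKmn m n} vertices ∈-vertices LAdj?

    lower-bound : m ≤ n → (D : TreeDecomposition (LKmn m n)) → Fin (t D) →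
                  ∃ λ s → LargeIndependentSet (bag D s)
    lower-bound m≤n D s₀ =
      let s , xs , independent , m≤ = decidable-lower-bound m≤n (refine D) (refine-bag? D) s₀
      in s , xs , IsIndep-mono {G = LKmn m n} (refine-⊆ D) independent , m≤

open TreeDecompositions using (trivialDecomposition)
open LineGraph using (α≤m; graph-independent; lower-bound)
open import Data.Nat.Properties using (≤-trans)
open import Data.Fin using (fromℕ<)
open import Data.List using (tabulate)
open import Data.List.Properties using (length-tabulate)
open import Data.Product using (_,_; proj₁)
open import Data.Unit using (tt)
open import Function using (id)

proposition5p6 : ∀ (m n : ℕ) → 1 ≤ m → m ≤ n →
    TreeAlphaIs (LKmn m n) m × AlphaIs (LKmn m m) m
proposition5p6 m n 1≤m m≤n =
  ( (trivialDecomposition _ , λ _ → α≤m _)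
  , λ D → lower-bound m≤n D (proj₁ (cover D (fromℕ< 1≤m , fromℕ< (≤-trans 1≤m m≤n)))) )
  , ( (tabulate (λ i → i , i) , graph-independent id id (λ _ → tt) , length-tabulate _)
    , α≤m _ )
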